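{- There exists a tetrahedron $\Delta\subset\mathbb{R}^3$ (not a lattice polytope) that is hollow with respect to $\mathbb{Z}^3$ and whose lattice width with respect to $\mathbb{Z}^3$ equals $2+\sqrt2$.
   Context: A convex body $K\subset\mathbb{R}^d$ is hollow with respect to a lattice $\Lambda\cong\mathbb{Z}^d$ if its interior contains no point of $\Lambda$. The width of $K$ with respect to a linear functional $f$ is the length of the segment $f(K)$; the lattice width of $K$ is $\operatorname{width}_\Lambda(K)=\inf_{f\in\Lambda^*\setminus\{0\}}\operatorname{width}(K,f)$, where $\Lambda^*$ is the dual lattice. -}

module Defs where

open import Data.Nat using (ℕ)
open import Data.Integer using (ℤ; +_)
open import Data.Rational as Q using (ℚ; 0ℚ; 1ℚ)
open import Data.Fin using (Fin; zero; suc)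
open import Data.Product using (Σ; ∃; _×_; _,_)
open import Data.Sum using (_⊎_)
open import Relation.Binary.PropositionalEquality using (_≡_)
open import Relation.Nullary using (¬_)

-- An element  a + b√2  is represented by the pair (a , b) of rationals.
-- Since √2 is irrational this representation is unique, so propositional
-- equality of pairs is equality of the corresponding real numbers.

record ℚ√2 : Set where
  constructor _+_√2
  field
    re : ℚ
    ir : ℚ
open ℚ√2 public

infixl 6 _⊕_ _⊖_
infixl 7 _⊗_

_⊕_ : ℚ√2 → ℚ√2 → ℚ√2
(a + b √2) ⊕ (c + d √2) = (a Q.+ c) + (b Q.+ d) √2

⊝_ : ℚ√2 → ℚ√2
⊝ (a + b √2) = (Q.- a) + (Q.- b) √2

_⊖_ : ℚ√2 → ℚ√2 → ℚ√2
x ⊖ y = x ⊕ (⊝ y)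

_⊗_ : ℚ√2 → ℚ√2 → ℚ√2
(a + b √2) ⊗ (c + d √2) =
  ((a Q.* c) Q.+ ((+ 2 Q./ 1) Q.* (b Q.* d))) + ((a Q.* d) Q.+ (b Q.* c)) √2

fromℚ : ℚ → ℚ√2
fromℚ q = q + 0ℚ √2

fromℤ : ℤ → ℚ√2
fromℤ z = fromℚ (z Q./ 1)

𝟘 𝟙 : ℚ√2
𝟘 = fromℚ 0ℚ
𝟙 = fromℚ 1ℚ

two+√2 : ℚ√2
two+√2 = (+ 2 Q./ 1) + 1ℚ √2

Pos : ℚ√2 → Set
Pos (a + b √2) =
    (0ℚ Q.≤ a × 0ℚ Q.≤ b × (0ℚ Q.< a ⊎ 0ℚ Q.< b))
  ⊎ (0ℚ Q.< a × b Q.< 0ℚ × (+ 2 Q./ 1) Q.* (b Q.* b) Q.< a Q.* a)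
  ⊎ (a Q.< 0ℚ × 0ℚ Q.< b × a Q.* a Q.< (+ 2 Q./ 1) Q.* (b Q.* b))

_<ᵣ_ : ℚ√2 → ℚ√2 → Set
x <ᵣ y = Pos (y ⊖ x)

_≤ᵣ_ : ℚ√2 → ℚ√2 → Set
x ≤ᵣ y = x <ᵣ y ⊎ x ≡ y

Pt : Set
Pt = Fin 3 → ℚ√2

ℤ³ : Set
ℤ³ = Fin 3 → ℤ

embed : ℤ³ → Pt
embed z i = fromℤ (z i)

sum4 : (Fin 4 → ℚ√2) → ℚ√2
sum4 f = f zero ⊕ f (suc zero) ⊕ f (suc (suc zero)) ⊕ f (suc (suc (suc zero)))

comb : (Fin 4 → ℚ√2) → (Fin 4 → Pt) → Pt
comb λs v k = sum4 (λ i → λs i ⊗ v i k)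

-- Evaluation of a dual-lattice functional f ∈ (ℤ³)* ≅ ℤ³ on a point.
eval : ℤ³ → Pt → ℚ√2
eval f p = (fromℤ (f zero) ⊗ p zero)
         ⊕ (fromℤ (f (suc zero)) ⊗ p (suc zero))
         ⊕ (fromℤ (f (suc (suc zero))) ⊗ p (suc (suc zero)))

NonZeroFunctional : ℤ³ → Set
NonZeroFunctional f = ¬ (∀ i → f i ≡ + 0)

AffinelyIndependent : (Fin 4 → Pt) → Set
AffinelyIndependent v =
  (μ : Fin 4 → ℚ√2) → sum4 μ ≡ 𝟘 → comb μ v ≡ (λ _ → 𝟘) → ∀ i → μ i ≡ 𝟘

InInterior : (Fin 4 → Pt) → Pt → Set
InInterior v p =
  Σ (Fin 4 → ℚ√2) λ λs → (∀ i → 𝟘 <ᵣ λs i) × sum4 λs ≡ 𝟙 × comb λs v ≡ p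

Hollow : (Fin 4 → Pt) → Set
Hollow v = ¬ (Σ ℤ³ λ z → InInterior v (embed z))

LatticePolytope : (Fin 4 → Pt) → Set
LatticePolytope v = ∀ i → Σ ℤ³ λ z → v i ≡ embed z

-- width(conv v, f) = max_i f(v_i) − min_j f(v_j).
-- "width(conv v, f) ≥ c":
WidthGE : (Fin 4 → Pt) → ℤ³ → ℚ√2 → Set
WidthGE v f c = Σ (Fin 4) λ i → Σ (Fin 4) λ j → c ≤ᵣ (eval f (v i) ⊖ eval f (v j))

WidthLT : (Fin 4 → Pt) → ℤ³ → ℚ√2 → Set
WidthLT v f c = ∀ i j → (eval f (v i) ⊖ eval f (v j)) <ᵣ c

-- Lattice width of conv v equals c, i.e. c = inf_{f ∈ ℤ³∖0} width(conv v, f):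
-- c is a lower bound, and for every rational ε > 0 some f has width < c + ε.
LatticeWidthEq : (Fin 4 → Pt) → ℚ√2 → Set
LatticeWidthEq v c =
    ((f : ℤ³) → NonZeroFunctional f → WidthGE v f c)
  × ((ε : ℚ) → 0ℚ Q.< ε → Σ ℤ³ λ f → NonZeroFunctional f × WidthLT v f (c ⊕ fromℚ ε))

module Submission where

open import Defs
open import Relation.Binary.PropositionalEquality
  using (_≡_; refl; sym; trans; cong; cong₂; subst; subst₂; isEquivalence; module ≡-Reasoning)
open import Algebra.Bundles using (CommutativeRing; CommutativeMonoid)
open import Algebra.Definitions {A = ℚ√2} _≡_
open import Algebra.Structures {A = ℚ√2} _≡_ using (IsCommutativeRing)
open import Data.Empty using (⊥)
open import Data.Fin using (Fin; zero; suc)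
open import Data.Fin.Properties using (any?; all?)
open import Data.Integer as ℤ using (ℤ; +_; -[1+_]; 0ℤ; -1ℤ; _+_; _-_; _*_; -_; _≤_; _<_; +≤+)
import Data.Integer.Properties as ℤP
import Data.Integer.Tactic.RingSolver as ℤ-Solver
open import Data.List using (allFin)
import Data.List.Extrema as Extrema
open import Data.List.Membership.Propositional.Properties using (∈-allFin)
import Data.List.Relation.Unary.All as All
open import Data.Maybe using (Maybe; just; nothing)
import Data.Nat as ℕ
open import Data.Product using (Σ; ∃; _×_; _,_; proj₁; proj₂)
open import Data.Rational as ℚ using (ℚ; 0ℚ; 1ℚ)
import Data.Rational.Properties as ℚP
open import Data.Rational.Unnormalised as ℚᵘ using (mkℚᵘ; *≡*; *≤*; *<*)
import Data.Rational.Unnormalised.Properties as ℚᵘP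
open import Data.Sum as Sum using (_⊎_; inj₁; inj₂)
open import Data.Vec.Functional using ([]; _∷_)
open import Level using (0ℓ)
open import Relation.Binary.Definitions using (DecidableEquality)
open import Relation.Nullary using (¬_; yes; no; contradiction)
open import Relation.Nullary.Decidable using (_×-dec_; toWitness)
import Tactic.RingSolver as Solver
open import Tactic.RingSolver.Core.AlmostCommutativeRing using (AlmostCommutativeRing; fromCommutativeRing)

-- In the coordinates p = (1 − x − y − z, x, y, z) of the hyperplane p₀ + p₁ + p₂ + p₃ = 1
-- of ℝ⁴, whose integer points are the lattice points, the vertices of Δ are
-- vᵢ = t(1,1,1,1) + eᵢ₊₁ − φeᵢ (indices mod 4) with φ = 1 + √2 and t = φ/4. So Δ is
-- invariant under the cyclic shift of coordinates, and its barycentric coordinates are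
--   4λᵢ = (3 − √2) pᵢ₊₁ + √2 pᵢ₊₂ + pᵢ₊₃.
--
-- Width: the functional f, read on ℝ⁴ as g = (0, f₀, f₁, f₂), takes the value
-- t(f₀ + f₁ + f₂) + gᵢ₊₁ − φgᵢ at vᵢ. If gᵢ is a maximum with gᵢ₊₁ < gᵢ and gⱼ a minimum
-- with gⱼ₊₁ > gⱼ, then f(vⱼ) − f(vᵢ) ≥ 2 + √2·(max g − min g) ≥ 2 + √2; the functional z
-- has width exactly 2 + √2.
--
-- Hollowness: at a lattice point 4λᵢ = (3pᵢ₊₁ + pᵢ₊₃) + (pᵢ₊₂ − pᵢ₊₁)√2, and by
-- 7/5 < √2 < 3/2 its positivity gives 2pᵢ ≤ pᵢ₊₁ + pᵢ₊₂ + 1 whenever pᵢ₊₁ < pᵢ. At a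
-- maximum M of p followed by a descent this forces p to read M, M − 1, M, M or M − 1 around
-- the cycle, so p₀ + p₁ + p₂ + p₃ = 1 would make 4M equal to 2 or 3.

ℚ-ring : AlmostCommutativeRing 0ℓ 0ℓ
ℚ-ring = fromCommutativeRing ℚP.+-*-commutativeRing isZero
  where
  isZero : (x : ℚ) → Maybe (0ℚ ≡ x)
  isZero x with 0ℚ ℚP.≟ x
  ... | yes p = just p
  ... | no _  = nothing

ι : ℤ → ℚ
ι a = a ℚ./ 1

-- a ℚ./ 1 is by definition the normalisation fromℚᵘ (mkℚᵘ a 0).
toℚᵘ-ι : ∀ a → ℚ.toℚᵘ (ι a) ℚᵘ.≃ mkℚᵘ a 0
toℚᵘ-ι a = ℚP.toℚᵘ-fromℚᵘ (mkℚᵘ a 0)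

ι-mono-≤ : ∀ {a b} → a ≤ b → ι a ℚ.≤ ι b
ι-mono-≤ {a} {b} a≤b = ℚP.toℚᵘ-cancel-≤
  (ℚᵘP.≤-respˡ-≃ (ℚᵘP.≃-sym (toℚᵘ-ι a)) (ℚᵘP.≤-respʳ-≃ (ℚᵘP.≃-sym (toℚᵘ-ι b))
    (*≤* (subst₂ _≤_ (sym (ℤP.*-identityʳ a)) (sym (ℤP.*-identityʳ b)) a≤b))))

ι-cancel-≤ : ∀ {a b} → ι a ℚ.≤ ι b → a ≤ b
ι-cancel-≤ {a} {b} ιa≤ιb
  with ℚᵘP.≤-respˡ-≃ (toℚᵘ-ι a) (ℚᵘP.≤-respʳ-≃ (toℚᵘ-ι b) (ℚP.toℚᵘ-mono-≤ ιa≤ιb))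
... | *≤* a*1≤b*1 = subst₂ _≤_ (ℤP.*-identityʳ a) (ℤP.*-identityʳ b) a*1≤b*1

ι-mono-< : ∀ {a b} → a < b → ι a ℚ.< ι b
ι-mono-< {a} {b} a<b = ℚP.toℚᵘ-cancel-<
  (ℚᵘP.<-respˡ-≃ (ℚᵘP.≃-sym (toℚᵘ-ι a)) (ℚᵘP.<-respʳ-≃ (ℚᵘP.≃-sym (toℚᵘ-ι b))
    (*<* (subst₂ _<_ (sym (ℤP.*-identityʳ a)) (sym (ℤP.*-identityʳ b)) a<b))))

ι-cancel-< : ∀ {a b} → ι a ℚ.< ι b → a < b
ι-cancel-< {a} {b} ιa<ιb
  with ℚᵘP.<-respˡ-≃ (toℚᵘ-ι a) (ℚᵘP.<-respʳ-≃ (toℚᵘ-ι b) (ℚP.toℚᵘ-mono-< ιa<ιb))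
... | *<* a*1<b*1 = subst₂ _<_ (ℤP.*-identityʳ a) (ℤP.*-identityʳ b) a*1<b*1

ι-homo-+ : ∀ a b → ι (a + b) ≡ ι a ℚ.+ ι b
ι-homo-+ a b = ℚP.toℚᵘ-injective (begin-equality
  ℚ.toℚᵘ (ι (a + b))             ≃⟨ toℚᵘ-ι (a + b) ⟩
  mkℚᵘ (a + b) 0                 ≃⟨ *≡* (cross a b) ⟩
  mkℚᵘ a 0 ℚᵘ.+ mkℚᵘ b 0         ≃⟨ ℚᵘP.+-cong (toℚᵘ-ι a) (toℚᵘ-ι b) ⟨
  ℚ.toℚᵘ (ι a) ℚᵘ.+ ℚ.toℚᵘ (ι b) ≃⟨ ℚP.toℚᵘ-homo-+ (ι a) (ι b) ⟨
  ℚ.toℚᵘ (ι a ℚ.+ ι b)           ∎)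
  where
  open ℚᵘP.≤-Reasoning
  cross : ∀ a b → (a + b) * + 1 ≡ (a * + 1 + b * + 1) * + 1
  cross = ℤ-Solver.solve-∀

ι-homo-* : ∀ a b → ι (a * b) ≡ ι a ℚ.* ι b
ι-homo-* a b = ℚP.toℚᵘ-injective (begin-equality
  ℚ.toℚᵘ (ι (a * b))             ≃⟨ toℚᵘ-ι (a * b) ⟩
  mkℚᵘ a 0 ℚᵘ.* mkℚᵘ b 0         ≃⟨ ℚᵘP.*-cong (toℚᵘ-ι a) (toℚᵘ-ι b) ⟨
  ℚ.toℚᵘ (ι a) ℚᵘ.* ℚ.toℚᵘ (ι b) ≃⟨ ℚP.toℚᵘ-homo-* (ι a) (ι b) ⟨
  ℚ.toℚᵘ (ι a ℚ.* ι b)           ∎)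
  where open ℚᵘP.≤-Reasoning

ι-homo‿- : ∀ a → ι (- a) ≡ ℚ.- ι a
ι-homo‿- a = ℚP.toℚᵘ-injective (begin-equality
  ℚ.toℚᵘ (ι (- a))  ≃⟨ toℚᵘ-ι (- a) ⟩
  ℚᵘ.- mkℚᵘ a 0     ≃⟨ ℚᵘP.-‿cong (toℚᵘ-ι a) ⟨
  ℚᵘ.- ℚ.toℚᵘ (ι a) ≃⟨ ℚP.toℚᵘ-homo‿- (ι a) ⟨
  ℚ.toℚᵘ (ℚ.- ι a)  ∎)
  where open ℚᵘP.≤-Reasoning

private
  0≤x*x : ∀ x → 0ℤ ≤ x * x
  0≤x*x (+ n)    = subst (0ℤ ≤_) (ℤP.pos-* n n) (+≤+ ℕ.z≤n)
  0≤x*x -[1+ n ] = +≤+ ℕ.z≤n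

  0<y-x : ∀ {x y} → x < y → 0ℤ < y - x
  0<y-x {x} {y} x<y = subst (_< y - x) (ℤP.+-inverseʳ x) (ℤP.+-monoˡ-< (- x) x<y)

  1≤y-x : ∀ {x y} → x < y → + 1 ≤ y - x
  1≤y-x {x} {y} x<y = subst (_≤ y - x) (cancel x) (ℤP.+-monoˡ-≤ (- x) (ℤP.i<j⇒suc[i]≤j x<y))
    where
    cancel : ∀ x → + 1 + x - x ≡ + 1
    cancel = ℤ-Solver.solve-∀

  0<x+1⇒0≤x : ∀ {x} → 0ℤ < x + + 1 → 0ℤ ≤ x
  0<x+1⇒0≤x {x} 0<x+1 = subst (0ℤ ≤_) (pred-suc x) (ℤP.i<j⇒i≤pred[j] 0<x+1)
    where
    pred-suc : ∀ x → -1ℤ + (x + + 1) ≡ x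
    pred-suc = ℤ-Solver.solve-∀

  0<x*y⇒0<x : ∀ {x y} → 0ℤ ≤ y → 0ℤ < x * y → 0ℤ < x
  0<x*y⇒0<x {x} {y} 0≤y 0<xy =
    ℤP.*-cancelʳ-<-nonNeg y {{ℤ.nonNegative 0≤y}} (subst (_< x * y) (sym (ℤP.*-zeroˡ y)) 0<xy)

  +-cancelˡ-≤ : ∀ i {j k} → i + j ≤ i + k → j ≤ k
  +-cancelˡ-≤ i {j} {k} i+j≤i+k = subst₂ _≤_ (cancel i j) (cancel i k) (ℤP.+-monoʳ-≤ (- i) i+j≤i+k)
    where
    cancel : ∀ i j → - i + (i + j) ≡ j
    cancel = ℤ-Solver.solve-∀

  0≤q-p : ∀ {p q} → p ℚ.≤ q → 0ℚ ℚ.≤ q ℚ.- p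
  0≤q-p {p} {q} p≤q = subst (ℚ._≤ q ℚ.- p) (ℚP.+-inverseʳ p) (ℚP.+-monoˡ-≤ (ℚ.- p) p≤q)

no-multiple-of-4 : ∀ x → + 1 ≤ + 4 * x → + 4 * x ≤ + 3 → ⊥
no-multiple-of-4 x 1≤4x 4x≤3 with 0ℤ ℤ.<? x
... | yes 0<x = contradiction (ℤP.≤-trans (ℤP.*-monoˡ-≤-nonNeg (+ 4) (ℤP.i<j⇒suc[i]≤j 0<x)) 4x≤3)
                              λ { (+≤+ (ℕ.s≤s (ℕ.s≤s (ℕ.s≤s ())))) }
... | no 0≮x  = contradiction (ℤP.≤-trans 1≤4x (ℤP.*-monoˡ-≤-nonNeg (+ 4) (ℤP.≮⇒≥ 0≮x)))
                              λ { (+≤+ ()) }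
-- The ring ℚ(√2)

two : ℚ
two = + 2 ℚ./ 1

_≟_ : DecidableEquality ℚ√2
(a + b √2) ≟ (c + d √2) with a ℚP.≟ c | b ℚP.≟ d
... | yes refl | yes refl = yes refl
... | no a≢c   | _        = no λ { refl → a≢c refl }
... | _        | no b≢d   = no λ { refl → b≢d refl }

⊕-assoc : Associative _⊕_
⊕-assoc (a + b √2) (c + d √2) (e + f √2) = cong₂ _+_√2 (ℚP.+-assoc a c e) (ℚP.+-assoc b d f)

⊕-comm : Commutative _⊕_
⊕-comm (a + b √2) (c + d √2) = cong₂ _+_√2 (ℚP.+-comm a c) (ℚP.+-comm b d)

⊕-identityˡ : LeftIdentity 𝟘 _⊕_
⊕-identityˡ (a + b √2) = cong₂ _+_√2 (ℚP.+-identityˡ a) (ℚP.+-identityˡ b)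

⊕-identityʳ : RightIdentity 𝟘 _⊕_
⊕-identityʳ (a + b √2) = cong₂ _+_√2 (ℚP.+-identityʳ a) (ℚP.+-identityʳ b)

⊕-inverseˡ : LeftInverse 𝟘 ⊝_ _⊕_
⊕-inverseˡ (a + b √2) = cong₂ _+_√2 (ℚP.+-inverseˡ a) (ℚP.+-inverseˡ b)

⊕-inverseʳ : RightInverse 𝟘 ⊝_ _⊕_
⊕-inverseʳ (a + b √2) = cong₂ _+_√2 (ℚP.+-inverseʳ a) (ℚP.+-inverseʳ b)

⊗-comm : Commutative _⊗_
⊗-comm (a + b √2) (c + d √2) = cong₂ _+_√2 (re-comm a b c d) (ir-comm a b c d)
  where
  re-comm : ∀ a b c d → a ℚ.* c ℚ.+ two ℚ.* (b ℚ.* d) ≡ c ℚ.* a ℚ.+ two ℚ.* (d ℚ.* b)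
  re-comm = Solver.solve-∀ ℚ-ring
  ir-comm : ∀ a b c d → a ℚ.* d ℚ.+ b ℚ.* c ≡ c ℚ.* b ℚ.+ d ℚ.* a
  ir-comm = Solver.solve-∀ ℚ-ring

⊗-assoc : Associative _⊗_
⊗-assoc (a + b √2) (c + d √2) (e + f √2) = cong₂ _+_√2 (re-assoc a b c d e f) (ir-assoc a b c d e f)
  where
  re-assoc : ∀ a b c d e f →
    (a ℚ.* c ℚ.+ two ℚ.* (b ℚ.* d)) ℚ.* e ℚ.+ two ℚ.* ((a ℚ.* d ℚ.+ b ℚ.* c) ℚ.* f)
      ≡ a ℚ.* (c ℚ.* e ℚ.+ two ℚ.* (d ℚ.* f)) ℚ.+ two ℚ.* (b ℚ.* (c ℚ.* f ℚ.+ d ℚ.* e))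
  re-assoc = Solver.solve-∀ ℚ-ring
  ir-assoc : ∀ a b c d e f →
    (a ℚ.* c ℚ.+ two ℚ.* (b ℚ.* d)) ℚ.* f ℚ.+ (a ℚ.* d ℚ.+ b ℚ.* c) ℚ.* e
      ≡ a ℚ.* (c ℚ.* f ℚ.+ d ℚ.* e) ℚ.+ b ℚ.* (c ℚ.* e ℚ.+ two ℚ.* (d ℚ.* f))
  ir-assoc = Solver.solve-∀ ℚ-ring

⊗-identityˡ : LeftIdentity 𝟙 _⊗_
⊗-identityˡ (a + b √2) = cong₂ _+_√2 (re-id a b) (ir-id a b)
  where
  re-id : ∀ a b → 1ℚ ℚ.* a ℚ.+ two ℚ.* (0ℚ ℚ.* b) ≡ a
  re-id = Solver.solve-∀ ℚ-ring
  ir-id : ∀ a b → 1ℚ ℚ.* b ℚ.+ 0ℚ ℚ.* a ≡ b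
  ir-id = Solver.solve-∀ ℚ-ring

⊗-distribʳ : _⊗_ DistributesOverʳ _⊕_
⊗-distribʳ (a + b √2) (c + d √2) (e + f √2) = cong₂ _+_√2 (re-distrib a b c d e f) (ir-distrib a b c d e f)
  where
  re-distrib : ∀ a b c d e f →
    (c ℚ.+ e) ℚ.* a ℚ.+ two ℚ.* ((d ℚ.+ f) ℚ.* b)
      ≡ (c ℚ.* a ℚ.+ two ℚ.* (d ℚ.* b)) ℚ.+ (e ℚ.* a ℚ.+ two ℚ.* (f ℚ.* b))
  re-distrib = Solver.solve-∀ ℚ-ring
  ir-distrib : ∀ a b c d e f →
    (c ℚ.+ e) ℚ.* b ℚ.+ (d ℚ.+ f) ℚ.* a ≡ (c ℚ.* b ℚ.+ d ℚ.* a) ℚ.+ (e ℚ.* b ℚ.+ f ℚ.* a)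
  ir-distrib = Solver.solve-∀ ℚ-ring

isCommutativeRing : IsCommutativeRing _⊕_ _⊗_ ⊝_ 𝟘 𝟙
isCommutativeRing = record
  { isRing = record
    { +-isAbelianGroup = record
      { isGroup = record
        { isMonoid = record
          { isSemigroup = record
            { isMagma = record { isEquivalence = isEquivalence ; ∙-cong = cong₂ _⊕_ }
            ; assoc   = ⊕-assoc
            }
          ; identity = ⊕-identityˡ , ⊕-identityʳ
          }
        ; inverse = ⊕-inverseˡ , ⊕-inverseʳ
        ; ⁻¹-cong = cong ⊝_
        }
      ; comm = ⊕-comm
      }
    ; *-cong     = cong₂ _⊗_
    ; *-assoc    = ⊗-assoc
    ; *-identity = ⊗-identityˡ , λ x → trans (⊗-comm x 𝟙) (⊗-identityˡ x)
    ; distrib    = ⊗-distribˡ , ⊗-distribʳ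
    }
  ; *-comm = ⊗-comm
  }
  where
  ⊗-distribˡ : _⊗_ DistributesOverˡ _⊕_
  ⊗-distribˡ x y z =
    trans (⊗-comm x (y ⊕ z)) (trans (⊗-distribʳ x y z) (cong₂ _⊕_ (⊗-comm y x) (⊗-comm z x)))

commutativeRing : CommutativeRing 0ℓ 0ℓ
commutativeRing = record { isCommutativeRing = isCommutativeRing }

⊕-commutativeMonoid : CommutativeMonoid 0ℓ 0ℓ
⊕-commutativeMonoid = CommutativeRing.+-commutativeMonoid commutativeRing

ℚ√2-ring : AlmostCommutativeRing 0ℓ 0ℓ
ℚ√2-ring = fromCommutativeRing commutativeRing isZero
  where
  isZero : (x : ℚ√2) → Maybe (𝟘 ≡ x)
  isZero x with 𝟘 ≟ x
  ... | yes p = just p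
  ... | no _  = nothing

-- Positivity

⟨_,_⟩ : ℤ → ℤ → ℚ√2
⟨ a , b ⟩ = ι a + ι b √2

⟨⟩-⊕ : ∀ a b c d → ⟨ a , b ⟩ ⊕ ⟨ c , d ⟩ ≡ ⟨ a + c , b + d ⟩
⟨⟩-⊕ a b c d = sym (cong₂ _+_√2 (ι-homo-+ a c) (ι-homo-+ b d))

⟨⟩-⊖ : ∀ a b c d → ⟨ a , b ⟩ ⊖ ⟨ c , d ⟩ ≡ ⟨ a - c , b - d ⟩
⟨⟩-⊖ a b c d = trans (cong (⟨ a , b ⟩ ⊕_) (sym (cong₂ _+_√2 (ι-homo‿- c) (ι-homo‿- d)))) (⟨⟩-⊕ a b (- c) (- d))

⟨⟩-⊗ : ∀ a b c d → ⟨ a , b ⟩ ⊗ ⟨ c , d ⟩ ≡ ⟨ a * c + + 2 * (b * d) , a * d + b * c ⟩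
⟨⟩-⊗ a b c d = sym (cong₂ _+_√2
  (trans (ι-homo-+ (a * c) (+ 2 * (b * d)))
         (cong₂ ℚ._+_ (ι-homo-* a c) (trans (ι-homo-* (+ 2) (b * d)) (cong (two ℚ.*_) (ι-homo-* b d)))))
  (trans (ι-homo-+ (a * d) (b * c)) (cong₂ ℚ._+_ (ι-homo-* a d) (ι-homo-* b c))))

nonNeg⟨⟩⇒Pos : ∀ {a b} → 0ℤ ≤ a → 0ℤ ≤ b → 0ℤ < a ⊎ 0ℤ < b → Pos ⟨ a , b ⟩
nonNeg⟨⟩⇒Pos 0≤a 0≤b 0<a⊎0<b = inj₁ (ι-mono-≤ 0≤a , ι-mono-≤ 0≤b , Sum.map ι-mono-< ι-mono-< 0<a⊎0<b)

module _ {a b : ℤ} where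

  private
    ι-a² : ι a ℚ.* ι a ≡ ι (a * a)
    ι-a² = sym (ι-homo-* a a)

    ι-2b² : two ℚ.* (ι b ℚ.* ι b) ≡ ι (+ 2 * (b * b))
    ι-2b² = sym (trans (ι-homo-* (+ 2) (b * b)) (cong (two ℚ.*_) (ι-homo-* b b)))

  Pos⟨⟩⇒ : Pos ⟨ a , b ⟩ →
      (0ℤ ≤ a × 0ℤ ≤ b × (0ℤ < a ⊎ 0ℤ < b))
    ⊎ (0ℤ < a × b < 0ℤ × + 2 * (b * b) < a * a)
    ⊎ (a < 0ℤ × 0ℤ < b × a * a < + 2 * (b * b))
  Pos⟨⟩⇒ (inj₁ (0≤a , 0≤b , 0<a⊎0<b)) =
    inj₁ (ι-cancel-≤ {0ℤ} 0≤a , ι-cancel-≤ {0ℤ} 0≤b , Sum.map (ι-cancel-< {0ℤ}) (ι-cancel-< {0ℤ}) 0<a⊎0<b)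
  Pos⟨⟩⇒ (inj₂ (inj₁ (0<a , b<0 , 2b²<a²))) =
    inj₂ (inj₁ (ι-cancel-< {0ℤ} 0<a , ι-cancel-< {b} {0ℤ} b<0 , ι-cancel-< (subst₂ ℚ._<_ ι-2b² ι-a² 2b²<a²)))
  Pos⟨⟩⇒ (inj₂ (inj₂ (a<0 , 0<b , a²<2b²))) =
    inj₂ (inj₂ (ι-cancel-< {a} {0ℤ} a<0 , ι-cancel-< {0ℤ} 0<b , ι-cancel-< (subst₂ ℚ._<_ ι-a² ι-2b² a²<2b²)))

-- 7/5 < √2 < 3/2. In the mixed-sign cases the quadratic inequality becomes linear after
-- multiplying by the nonnegative conjugate of the rational approximation.
module _ {a b : ℤ} where

  Pos⟨⟩⇒0<2a+3b : Pos ⟨ a , b ⟩ → 0ℤ ≤ b → 0ℤ < + 2 * a + + 3 * b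
  Pos⟨⟩⇒0<2a+3b pos 0≤b with Pos⟨⟩⇒ {a} {b} pos
  ... | inj₁ (0≤a , _ , inj₁ 0<a) =
    ℤP.+-mono-<-≤ (ℤP.*-monoˡ-<-pos (+ 2) 0<a) (ℤP.*-monoˡ-≤-nonNeg (+ 3) 0≤b)
  ... | inj₁ (0≤a , _ , inj₂ 0<b) =
    ℤP.+-mono-≤-< (ℤP.*-monoˡ-≤-nonNeg (+ 2) 0≤a) (ℤP.*-monoˡ-<-pos (+ 3) 0<b)
  ... | inj₂ (inj₁ (_ , b<0 , _)) = contradiction 0≤b (ℤP.<⇒≱ b<0)
  ... | inj₂ (inj₂ (a<0 , 0<b , a²<2b²)) = 0<x*y⇒0<x 0≤3b-2a (subst (0ℤ <_) (sym (conjugate a b))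
    (ℤP.+-mono-<-≤ (ℤP.*-monoˡ-<-pos (+ 4) (0<y-x a²<2b²)) (0≤x*x b)))
    where
    0≤3b-2a : 0ℤ ≤ + 3 * b - + 2 * a
    0≤3b-2a = ℤP.i≤j⇒0≤j-i (ℤP.≤-trans (ℤP.*-monoˡ-≤-nonNeg (+ 2) (ℤP.<⇒≤ a<0)) (ℤP.*-monoˡ-≤-nonNeg (+ 3) 0≤b))
    conjugate : ∀ a b → (+ 2 * a + + 3 * b) * (+ 3 * b - + 2 * a) ≡ + 4 * (+ 2 * (b * b) - a * a) + b * b
    conjugate = ℤ-Solver.solve-∀

  Pos⟨⟩⇒0<5a+7b : Pos ⟨ a , b ⟩ → b ≤ 0ℤ → 0ℤ < + 5 * a + + 7 * b
  Pos⟨⟩⇒0<5a+7b pos b≤0 with Pos⟨⟩⇒ {a} {b} pos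
  ... | inj₁ (_ , 0≤b , inj₁ 0<a) =
    ℤP.+-mono-<-≤ (ℤP.*-monoˡ-<-pos (+ 5) 0<a) (ℤP.*-monoˡ-≤-nonNeg (+ 7) 0≤b)
  ... | inj₁ (_ , _ , inj₂ 0<b) = contradiction b≤0 (ℤP.<⇒≱ 0<b)
  ... | inj₂ (inj₁ (0<a , b<0 , 2b²<a²)) = 0<x*y⇒0<x 0≤5a-7b (subst (0ℤ <_) (sym (conjugate a b))
    (ℤP.+-mono-<-≤ (ℤP.*-monoˡ-<-pos (+ 25) (0<y-x 2b²<a²)) (0≤x*x b)))
    where
    0≤5a-7b : 0ℤ ≤ + 5 * a - + 7 * b
    0≤5a-7b = ℤP.i≤j⇒0≤j-i (ℤP.≤-trans (ℤP.*-monoˡ-≤-nonNeg (+ 7) b≤0) (ℤP.*-monoˡ-≤-nonNeg (+ 5) (ℤP.<⇒≤ 0<a)))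
    conjugate : ∀ a b → (+ 5 * a + + 7 * b) * (+ 5 * a - + 7 * b) ≡ + 25 * (a * a - + 2 * (b * b)) + b * b
    conjugate = ℤ-Solver.solve-∀
  ... | inj₂ (inj₂ (_ , 0<b , _)) = contradiction b≤0 (ℤP.<⇒≱ 0<b)

two+√2≤⟨⟩ : ∀ {a b} → + 2 ≤ a → + 1 ≤ b → two+√2 ≤ᵣ ⟨ a , b ⟩
two+√2≤⟨⟩ {a} {b} 2≤a 1≤b with a ℤ.≟ + 2 | b ℤ.≟ + 1
... | yes refl | yes refl = inj₂ refl
... | no a≢2   | _        = inj₁ (subst Pos (sym (⟨⟩-⊖ a b (+ 2) (+ 1)))
  (nonNeg⟨⟩⇒Pos (ℤP.i≤j⇒0≤j-i 2≤a) (ℤP.i≤j⇒0≤j-i 1≤b) (inj₁ (0<y-x (ℤP.≤∧≢⇒< 2≤a λ 2≡a → a≢2 (sym 2≡a))))))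
... | yes _    | no b≢1   = inj₁ (subst Pos (sym (⟨⟩-⊖ a b (+ 2) (+ 1)))
  (nonNeg⟨⟩⇒Pos (ℤP.i≤j⇒0≤j-i 2≤a) (ℤP.i≤j⇒0≤j-i 1≤b) (inj₂ (0<y-x (ℤP.≤∧≢⇒< 1≤b λ 1≡b → b≢1 (sym 1≡b))))))

below-two+√2+ε : ∀ {ε} d → 0ℚ ℚ.< ε → re d ℚ.≤ two → ir d ℚ.≤ 1ℚ → d <ᵣ (two+√2 ⊕ fromℚ ε)
below-two+√2+ε {ε} (r + s √2) 0<ε r≤2 s≤1 = inj₁ (ℚP.<⇒≤ 0<re , 0≤q-p s≤1 , inj₁ 0<re)
  where
  shuffle : ∀ x ε r → x ℚ.- r ℚ.+ ε ≡ x ℚ.+ ε ℚ.- r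
  shuffle = Solver.solve-∀ ℚ-ring
  0<re : 0ℚ ℚ.< two ℚ.+ ε ℚ.- r
  0<re = subst (0ℚ ℚ.<_) (shuffle two ε r) (ℚP.+-mono-≤-< (0≤q-p r≤2) 0<ε)

fromℚ-⊗ : ∀ q a b → fromℚ q ⊗ (a + b √2) ≡ (q ℚ.* a) + (q ℚ.* b) √2
fromℚ-⊗ q a b = cong₂ _+_√2 (re-part q a b) (ir-part q a b)
  where
  re-part : ∀ q a b → q ℚ.* a ℚ.+ two ℚ.* (0ℚ ℚ.* b) ≡ q ℚ.* a
  re-part = Solver.solve-∀ ℚ-ring
  ir-part : ∀ q a b → q ℚ.* b ℚ.+ 0ℚ ℚ.* a ≡ q ℚ.* b
  ir-part = Solver.solve-∀ ℚ-ring

pos*Pos⇒Pos : ∀ {q} x → 0ℚ ℚ.< q → Pos x → Pos (fromℚ q ⊗ x)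
pos*Pos⇒Pos {q} (a + b √2) 0<q pos = subst Pos (sym (fromℚ-⊗ q a b)) (scale pos)
  where
  instance
    q-pos : ℚ.Positive q
    q-pos = ℚ.positive 0<q
    q-nonNeg : ℚ.NonNegative q
    q-nonNeg = ℚ.nonNegative (ℚP.<⇒≤ 0<q)
    q²-pos : ℚ.Positive (q ℚ.* q)
    q²-pos = ℚP.pos*pos⇒pos q q

  0≤q* : ∀ {u} → 0ℚ ℚ.≤ u → 0ℚ ℚ.≤ q ℚ.* u
  0≤q* {u} 0≤u = subst (ℚ._≤ q ℚ.* u) (ℚP.*-zeroʳ q) (ℚP.*-monoˡ-≤-nonNeg q 0≤u)

  0<q* : ∀ {u} → 0ℚ ℚ.< u → 0ℚ ℚ.< q ℚ.* u
  0<q* {u} 0<u = subst (ℚ._< q ℚ.* u) (ℚP.*-zeroʳ q) (ℚP.*-monoʳ-<-pos q 0<u)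

  q*<0 : ∀ {u} → u ℚ.< 0ℚ → q ℚ.* u ℚ.< 0ℚ
  q*<0 {u} u<0 = subst (q ℚ.* u ℚ.<_) (ℚP.*-zeroʳ q) (ℚP.*-monoʳ-<-pos q u<0)

  square : ∀ q u → (q ℚ.* u) ℚ.* (q ℚ.* u) ≡ (q ℚ.* q) ℚ.* (u ℚ.* u)
  square = Solver.solve-∀ ℚ-ring

  twice-square : ∀ q u → two ℚ.* ((q ℚ.* u) ℚ.* (q ℚ.* u)) ≡ (q ℚ.* q) ℚ.* (two ℚ.* (u ℚ.* u))
  twice-square = Solver.solve-∀ ℚ-ring

  q²*-mono-< : ∀ {u v} → u ℚ.< v → (q ℚ.* q) ℚ.* u ℚ.< (q ℚ.* q) ℚ.* v
  q²*-mono-< = ℚP.*-monoʳ-<-pos (q ℚ.* q)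

  scale : Pos (a + b √2) → Pos ((q ℚ.* a) + (q ℚ.* b) √2)
  scale (inj₁ (0≤a , 0≤b , 0<a⊎0<b)) = inj₁ (0≤q* 0≤a , 0≤q* 0≤b , Sum.map 0<q* 0<q* 0<a⊎0<b)
  scale (inj₂ (inj₁ (0<a , b<0 , 2b²<a²))) = inj₂ (inj₁ (0<q* 0<a , q*<0 b<0 ,
    subst₂ ℚ._<_ (sym (twice-square q b)) (sym (square q a)) (q²*-mono-< 2b²<a²)))
  scale (inj₂ (inj₂ (a<0 , 0<b , a²<2b²))) = inj₂ (inj₂ (q*<0 a<0 , 0<q* 0<b ,
    subst₂ ℚ._<_ (sym (square q a)) (sym (twice-square q b)) (q²*-mono-< a²<2b²)))

-- Cyclic sequences of length four

next : Fin 4 → Fin 4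
next zero                   = suc zero
next (suc zero)             = suc (suc zero)
next (suc (suc zero))       = suc (suc (suc zero))
next (suc (suc (suc zero))) = zero

next⁴ : ∀ i → next (next (next (next i))) ≡ i
next⁴ zero                   = refl
next⁴ (suc zero)             = refl
next⁴ (suc (suc zero))       = refl
next⁴ (suc (suc (suc zero))) = refl

module _ (M : CommutativeMonoid 0ℓ 0ℓ) where
  open CommutativeMonoid M
    using (Carrier; _∙_; _≈_; setoid; assoc; comm; ∙-congʳ) renaming (refl to ≈-refl; trans to ≈-trans)
  open import Relation.Binary.Reasoning.Setoid setoid

  private
    rotate₁ : ∀ a b c d → a ∙ b ∙ c ∙ d ≈ b ∙ c ∙ d ∙ a
    rotate₁ a b c d = begin
      a ∙ b ∙ c ∙ d     ≈⟨ assoc (a ∙ b) c d ⟩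
      a ∙ b ∙ (c ∙ d)   ≈⟨ assoc a b (c ∙ d) ⟩
      a ∙ (b ∙ (c ∙ d)) ≈⟨ comm a _ ⟩
      b ∙ (c ∙ d) ∙ a   ≈⟨ ∙-congʳ (assoc b c d) ⟨
      b ∙ c ∙ d ∙ a     ∎

  rotate-sum : ∀ (l : Fin 4 → Carrier) i →
    l zero ∙ l (suc zero) ∙ l (suc (suc zero)) ∙ l (suc (suc (suc zero)))
      ≈ l i ∙ l (next i) ∙ l (next (next i)) ∙ l (next (next (next i)))
  rotate-sum l zero                   = ≈-refl
  rotate-sum l (suc zero)             = rotate₁ _ _ _ _
  rotate-sum l (suc (suc zero))       = ≈-trans (rotate₁ _ _ _ _) (rotate₁ _ _ _ _)
  rotate-sum l (suc (suc (suc zero))) = ≈-trans (rotate₁ _ _ _ _) (≈-trans (rotate₁ _ _ _ _) (rotate₁ _ _ _ _))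

cyclic-closure : ∀ {P : Fin 4 → Set} → (∀ i → P i → P (next i)) → ∀ i → P i → ∀ j → P j
cyclic-closure {P} step i Pi j = from-zero j (to-zero i Pi)
  where
  to-zero : ∀ i → P i → P zero
  to-zero zero                   p = p
  to-zero (suc zero)             p = step (suc (suc (suc zero))) (step (suc (suc zero)) (step (suc zero) p))
  to-zero (suc (suc zero))       p = step (suc (suc (suc zero))) (step (suc (suc zero)) p)
  to-zero (suc (suc (suc zero))) p = step (suc (suc (suc zero))) p
  from-zero : ∀ j → P zero → P j
  from-zero zero                   p = p
  from-zero (suc zero)             p = step zero p
  from-zero (suc (suc zero))       p = step (suc zero) (step zero p)
  from-zero (suc (suc (suc zero))) p = step (suc (suc zero)) (step (suc zero) (step zero p))

IsMax : (Fin 4 → ℤ) → Fin 4 → Set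
IsMax g i = ∀ j → g j ≤ g i

maximum : ∀ g → ∃ (IsMax g)
maximum g = argmax g zero (allFin 4) , λ j → All.lookup (f[xs]≤f[argmax] {f = g} zero (allFin 4)) (∈-allFin j)
  where open Extrema ℤP.≤-totalOrder

descent-at-max : ∀ g → ¬ (∀ i j → g i ≤ g j) → ∃ λ i → IsMax g i × g (next i) < g i
descent-at-max g nonconstant with any? (λ i → all? (λ j → g j ℤ.≤? g i) ×-dec g (next i) ℤ.<? g i)
... | yes found = found
... | no none   = contradiction (λ i j → everywhere-max j i) nonconstant
  where
  max-next : ∀ i → IsMax g i → IsMax g (next i)
  max-next i i-max j with g (next i) ℤ.<? g i
  ... | yes descent   = contradiction (i , i-max , descent) none
  ... | no no-descent = ℤP.≤-trans (i-max j) (ℤP.≮⇒≥ no-descent)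
  everywhere-max : ∀ i → IsMax g i
  everywhere-max = cyclic-closure max-next (proj₁ (maximum g)) (proj₂ (maximum g))

sum≡1⇒nonconstant : ∀ (P : Fin 4 → ℤ) →
  P zero + P (suc zero) + P (suc (suc zero)) + P (suc (suc (suc zero))) ≡ + 1 → ¬ (∀ i j → P i ≤ P j)
sum≡1⇒nonconstant P ΣP≡1 const =
  no-multiple-of-4 (P zero) (ℤP.≤-reflexive (sym 4P₀≡1)) (ℤP.≤-trans (ℤP.≤-reflexive 4P₀≡1) (+≤+ (ℕ.s≤s ℕ.z≤n)))
  where
  open ≡-Reasoning
  P≡P₀ : ∀ i → P i ≡ P zero
  P≡P₀ i = ℤP.≤-antisym (const i zero) (const zero i)
  four : ∀ x → x + x + x + x ≡ + 4 * x
  four = ℤ-Solver.solve-∀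
  4P₀≡1 : + 4 * P zero ≡ + 1
  4P₀≡1 = begin
    + 4 * P zero                      ≡⟨ four (P zero) ⟨
    P zero + P zero + P zero + P zero ≡⟨ cong₂ _+_ (cong₂ _+_ (cong (λ x → P zero + x) (P≡P₀ (suc zero)))
                                                              (P≡P₀ (suc (suc zero))))
                                                   (P≡P₀ (suc (suc (suc zero)))) ⟨
    P zero + P (suc zero) + P (suc (suc zero)) + P (suc (suc (suc zero))) ≡⟨ ΣP≡1 ⟩
    + 1                               ∎

module _ (P : Fin 4 → ℤ) (bound : ∀ i → P (next i) < P i → + 2 * P i ≤ P (next i) + P (next (next i)) + + 1) where

  descent-from-max : ∀ i → IsMax P i → P (next i) < P i → P i ≤ + 1 + P (next (next (next i)))
  descent-from-max i i-max a<M = M≤1+c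
    where
    open ℤP.≤-Reasoning
    M a b c : ℤ
    M = P i
    a = P (next i)
    b = P (next (next i))
    c = P (next (next (next i)))

    double : ∀ x → x + x ≡ + 2 * x
    double = ℤ-Solver.solve-∀

    M≤b : M ≤ b
    M≤b = +-cancelˡ-≤ M (begin
      M + M       ≡⟨ double M ⟩
      + 2 * M     ≤⟨ bound i a<M ⟩
      a + b + + 1 ≡⟨ shuffle a b ⟩
      + 1 + a + b ≤⟨ ℤP.+-monoˡ-≤ b (ℤP.i<j⇒suc[i]≤j a<M) ⟩
      M + b       ∎)
      where
      shuffle : ∀ a b → a + b + + 1 ≡ + 1 + a + b
      shuffle = ℤ-Solver.solve-∀

    M≤1+c : M ≤ + 1 + c
    M≤1+c with c ℤ.<? b
    ... | yes c<b = +-cancelˡ-≤ M (begin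
      M + M                                     ≤⟨ ℤP.+-mono-≤ M≤b M≤b ⟩
      b + b                                     ≡⟨ double b ⟩
      + 2 * b                                   ≤⟨ bound (next (next i)) c<b ⟩
      c + P (next (next (next (next i)))) + + 1 ≡⟨ cong (λ j → c + P j + + 1) (next⁴ i) ⟩
      c + M + + 1                               ≡⟨ shuffle c M ⟩
      M + (+ 1 + c)                             ∎)
      where
      shuffle : ∀ c M → c + M + + 1 ≡ M + (+ 1 + c)
      shuffle = ℤ-Solver.solve-∀
    ... | no c≮b = ℤP.i≤j⇒i≤1+j (ℤP.≤-trans M≤b (ℤP.≮⇒≥ c≮b))

  cyclic-descent-contradiction : P zero + P (suc zero) + P (suc (suc zero)) + P (suc (suc (suc zero))) ≡ + 1 → ⊥
  cyclic-descent-contradiction ΣP≡1 with descent-at-max P (sum≡1⇒nonconstant P ΣP≡1)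
  ... | i , i-max , a<M = no-multiple-of-4 M 1≤4M 4M≤3
    where
    open ℤP.≤-Reasoning
    M a b c : ℤ
    M = P i
    a = P (next i)
    b = P (next (next i))
    c = P (next (next (next i)))

    sum-from-i : M + a + b + c ≡ + 1
    sum-from-i = trans (sym (rotate-sum ℤP.+-0-commutativeMonoid P i)) ΣP≡1

    4M≤3 : + 4 * M ≤ + 3
    4M≤3 = begin
      + 4 * M                     ≡⟨ split M ⟩
      + 2 * M + M + M             ≤⟨ ℤP.+-mono-≤ (ℤP.+-monoˡ-≤ M (bound i a<M)) (descent-from-max i i-max a<M) ⟩
      a + b + + 1 + M + (+ 1 + c) ≡⟨ regroup M a b c ⟩
      M + a + b + c + + 2         ≡⟨ cong (_+ + 2) sum-from-i ⟩
      + 3                         ∎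
      where
      split : ∀ M → + 4 * M ≡ + 2 * M + M + M
      split = ℤ-Solver.solve-∀
      regroup : ∀ M a b c → a + b + + 1 + M + (+ 1 + c) ≡ M + a + b + c + + 2
      regroup = ℤ-Solver.solve-∀

    1≤4M : + 1 ≤ + 4 * M
    1≤4M = ℤP.≤-trans (+≤+ (ℕ.s≤s ℕ.z≤n)) (begin
      + 2                   ≡⟨ cong (_+ + 1) sum-from-i ⟨
      M + a + b + c + + 1   ≡⟨ regroup M a b c ⟩
      M + (+ 1 + a) + b + c ≤⟨ ℤP.+-mono-≤ (ℤP.+-mono-≤ (ℤP.+-monoʳ-≤ M (ℤP.i<j⇒suc[i]≤j a<M)) (i-max _)) (i-max _) ⟩
      M + M + M + M         ≡⟨ four M ⟩
      + 4 * M               ∎)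
      where
      regroup : ∀ M a b c → M + a + b + c + + 1 ≡ M + (+ 1 + a) + b + c
      regroup = ℤ-Solver.solve-∀
      four : ∀ x → x + x + x + x ≡ + 4 * x
      four = ℤ-Solver.solve-∀

-- The tetrahedron

φ t ¼ : ℚ√2
φ = ⟨ + 1 , + 1 ⟩
t = (+ 1 ℚ./ 4) + (+ 1 ℚ./ 4) √2
¼ = fromℚ (+ 1 ℚ./ 4)

vertex : Fin 4 → Pt
vertex zero                   = t ⊕ 𝟙 ∷ t     ∷ t     ∷ []
vertex (suc zero)             = t ⊖ φ ∷ t ⊕ 𝟙 ∷ t     ∷ []
vertex (suc (suc zero))       = t     ∷ t ⊖ φ ∷ t ⊕ 𝟙 ∷ []
vertex (suc (suc (suc zero))) = t     ∷ t     ∷ t ⊖ φ ∷ []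

lift : ℚ√2 → Pt → Fin 4 → ℚ√2
lift S p = S ⊖ p zero ⊖ p (suc zero) ⊖ p (suc (suc zero)) ∷ p

lift-comb : ∀ l i → lift (sum4 l) (comb l vertex) (next i) ≡ t ⊗ sum4 l ⊕ l i ⊖ φ ⊗ l (next i)
lift-comb l zero                   = coordinate₁ (l zero) (l (suc zero)) (l (suc (suc zero))) (l (suc (suc (suc zero))))
  where
  coordinate₁ : ∀ a b c d → a ⊗ (t ⊕ 𝟙) ⊕ b ⊗ (t ⊖ φ) ⊕ c ⊗ t ⊕ d ⊗ t ≡ t ⊗ (a ⊕ b ⊕ c ⊕ d) ⊕ a ⊖ φ ⊗ b
  coordinate₁ = Solver.solve-∀ ℚ√2-ring
lift-comb l (suc zero)             = coordinate₂ (l zero) (l (suc zero)) (l (suc (suc zero))) (l (suc (suc (suc zero))))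
  where
  coordinate₂ : ∀ a b c d → a ⊗ t ⊕ b ⊗ (t ⊕ 𝟙) ⊕ c ⊗ (t ⊖ φ) ⊕ d ⊗ t ≡ t ⊗ (a ⊕ b ⊕ c ⊕ d) ⊕ b ⊖ φ ⊗ c
  coordinate₂ = Solver.solve-∀ ℚ√2-ring
lift-comb l (suc (suc zero))       = coordinate₃ (l zero) (l (suc zero)) (l (suc (suc zero))) (l (suc (suc (suc zero))))
  where
  coordinate₃ : ∀ a b c d → a ⊗ t ⊕ b ⊗ t ⊕ c ⊗ (t ⊕ 𝟙) ⊕ d ⊗ (t ⊖ φ) ≡ t ⊗ (a ⊕ b ⊕ c ⊕ d) ⊕ c ⊖ φ ⊗ d
  coordinate₃ = Solver.solve-∀ ℚ√2-ring
lift-comb l (suc (suc (suc zero))) = coordinate₀ (l zero) (l (suc zero)) (l (suc (suc zero))) (l (suc (suc (suc zero))))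
  where
  coordinate₀ : ∀ a b c d →
    (a ⊕ b ⊕ c ⊕ d) ⊖ (a ⊗ (t ⊕ 𝟙) ⊕ b ⊗ (t ⊖ φ) ⊕ c ⊗ t ⊕ d ⊗ t)
                    ⊖ (a ⊗ t ⊕ b ⊗ (t ⊕ 𝟙) ⊕ c ⊗ (t ⊖ φ) ⊕ d ⊗ t)
                    ⊖ (a ⊗ t ⊕ b ⊗ t ⊕ c ⊗ (t ⊕ 𝟙) ⊕ d ⊗ (t ⊖ φ))
      ≡ t ⊗ (a ⊕ b ⊕ c ⊕ d) ⊕ d ⊖ φ ⊗ a
  coordinate₀ = Solver.solve-∀ ℚ√2-ring

barycentric-form : ℚ√2 → ℚ√2 → ℚ√2 → ℚ√2
barycentric-form x y z = ¼ ⊗ (⟨ + 3 , -1ℤ ⟩ ⊗ x ⊕ ⟨ 0ℤ , + 1 ⟩ ⊗ y ⊕ z)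

barycentric : Fin 4 → ℚ√2 → Pt → ℚ√2
barycentric i S p = barycentric-form (p̂ (next i)) (p̂ (next (next i))) (p̂ (next (next (next i))))
  where p̂ = lift S p

private
  cong₃ : ∀ {A B C D : Set} (f : A → B → C → D) {x y z u v w} → x ≡ u → y ≡ v → z ≡ w → f x y z ≡ f u v w
  cong₃ f refl refl refl = refl

barycentric-comb : ∀ l i → barycentric i (sum4 l) (comb l vertex) ≡ l i
barycentric-comb l i = begin
  barycentric i S (comb l vertex)
    ≡⟨ cong₃ barycentric-form (lift-comb l i) (lift-comb l (next i)) (lift-comb l (next (next i))) ⟩
  barycentric-form (t ⊗ S ⊕ a ⊖ φ ⊗ b) (t ⊗ S ⊕ b ⊖ φ ⊗ c) (t ⊗ S ⊕ c ⊖ φ ⊗ d)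
    ≡⟨ cong (λ S → barycentric-form (t ⊗ S ⊕ a ⊖ φ ⊗ b) (t ⊗ S ⊕ b ⊖ φ ⊗ c) (t ⊗ S ⊕ c ⊖ φ ⊗ d))
            (rotate-sum ⊕-commutativeMonoid l i) ⟩
  barycentric-form (t ⊗ S′ ⊕ a ⊖ φ ⊗ b) (t ⊗ S′ ⊕ b ⊖ φ ⊗ c) (t ⊗ S′ ⊕ c ⊖ φ ⊗ d)
    ≡⟨ inversion a b c d ⟩
  a ∎
  where
  open ≡-Reasoning
  S = sum4 l
  a = l i
  b = l (next i)
  c = l (next (next i))
  d = l (next (next (next i)))
  S′ = a ⊕ b ⊕ c ⊕ d
  inversion : ∀ a b c d → let S = a ⊕ b ⊕ c ⊕ d in
    ¼ ⊗ (⟨ + 3 , -1ℤ ⟩ ⊗ (t ⊗ S ⊕ a ⊖ φ ⊗ b) ⊕ ⟨ 0ℤ , + 1 ⟩ ⊗ (t ⊗ S ⊕ b ⊖ φ ⊗ c) ⊕ (t ⊗ S ⊕ c ⊖ φ ⊗ d)) ≡ a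
  inversion = Solver.solve-∀ ℚ√2-ring

affinelyIndependent : AffinelyIndependent vertex
affinelyIndependent μ Σμ≡0 combμ≡0 i = begin
  μ i                                    ≡⟨ barycentric-comb μ i ⟨
  barycentric i (sum4 μ) (comb μ vertex) ≡⟨ cong₂ (barycentric i) Σμ≡0 combμ≡0 ⟩
  barycentric i 𝟘 (λ _ → 𝟘)              ≡⟨ barycentric-origin i ⟩
  𝟘                                      ∎
  where
  open ≡-Reasoning
  barycentric-origin : ∀ i → barycentric i 𝟘 (λ _ → 𝟘) ≡ 𝟘
  barycentric-origin zero                   = refl
  barycentric-origin (suc zero)             = refl
  barycentric-origin (suc (suc zero))       = refl
  barycentric-origin (suc (suc (suc zero))) = refl

notLattice : ¬ LatticePolytope vertex
notLattice lattice with lattice zero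
... | z , v₀≡z with cong (λ p → ir (p (suc zero))) v₀≡z
... | ()

-- Hollowness

liftℤ : ℤ³ → Fin 4 → ℤ
liftℤ z = + 1 - z zero - z (suc zero) - z (suc (suc zero)) ∷ z

lift-embed : ∀ z m → lift 𝟙 (embed z) m ≡ fromℤ (liftℤ z m)
lift-embed z zero = begin
  𝟙 ⊖ fromℤ z₀ ⊖ fromℤ z₁ ⊖ fromℤ z₂     ≡⟨ cong (λ x → x ⊖ fromℤ z₁ ⊖ fromℤ z₂) (⟨⟩-⊖ (+ 1) 0ℤ z₀ 0ℤ) ⟩
  fromℤ (+ 1 - z₀) ⊖ fromℤ z₁ ⊖ fromℤ z₂ ≡⟨ cong (_⊖ fromℤ z₂) (⟨⟩-⊖ (+ 1 - z₀) 0ℤ z₁ 0ℤ) ⟩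
  fromℤ (+ 1 - z₀ - z₁) ⊖ fromℤ z₂       ≡⟨ ⟨⟩-⊖ (+ 1 - z₀ - z₁) 0ℤ z₂ 0ℤ ⟩
  fromℤ (+ 1 - z₀ - z₁ - z₂)             ∎
  where
  open ≡-Reasoning
  z₀ = z zero
  z₁ = z (suc zero)
  z₂ = z (suc (suc zero))
lift-embed z (suc k) = refl

lattice-form : ∀ a b c →
  ⟨ + 3 , -1ℤ ⟩ ⊗ fromℤ a ⊕ ⟨ 0ℤ , + 1 ⟩ ⊗ fromℤ b ⊕ fromℤ c ≡ ⟨ + 3 * a + c , b - a ⟩
lattice-form a b c = begin
  ⟨ + 3 , -1ℤ ⟩ ⊗ ⟨ a , 0ℤ ⟩ ⊕ ⟨ 0ℤ , + 1 ⟩ ⊗ ⟨ b , 0ℤ ⟩ ⊕ ⟨ c , 0ℤ ⟩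
    ≡⟨ cong (_⊕ ⟨ c , 0ℤ ⟩) (cong₂ _⊕_ (⟨⟩-⊗ (+ 3) -1ℤ a 0ℤ) (⟨⟩-⊗ 0ℤ (+ 1) b 0ℤ)) ⟩
  ⟨ A₁ , B₁ ⟩ ⊕ ⟨ A₂ , B₂ ⟩ ⊕ ⟨ c , 0ℤ ⟩
    ≡⟨ cong (_⊕ ⟨ c , 0ℤ ⟩) (⟨⟩-⊕ A₁ B₁ A₂ B₂) ⟩
  ⟨ A₁ + A₂ , B₁ + B₂ ⟩ ⊕ ⟨ c , 0ℤ ⟩
    ≡⟨ ⟨⟩-⊕ (A₁ + A₂) (B₁ + B₂) c 0ℤ ⟩
  ⟨ A₁ + A₂ + c , B₁ + B₂ + 0ℤ ⟩
    ≡⟨ cong₂ ⟨_,_⟩ (re-part a b c) (ir-part a b) ⟩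
  ⟨ + 3 * a + c , b - a ⟩
    ∎
  where
  open ≡-Reasoning
  A₁ = + 3 * a + + 2 * (-1ℤ * 0ℤ)
  B₁ = + 3 * 0ℤ + -1ℤ * a
  A₂ = 0ℤ * b + + 2 * (+ 1 * 0ℤ)
  B₂ = 0ℤ * 0ℤ + + 1 * b
  re-part : ∀ a b c → + 3 * a + + 2 * (-1ℤ * 0ℤ) + (0ℤ * b + + 2 * (+ 1 * 0ℤ)) + c ≡ + 3 * a + c
  re-part = ℤ-Solver.solve-∀
  ir-part : ∀ a b → + 3 * 0ℤ + -1ℤ * a + (0ℤ * 0ℤ + + 1 * b) + 0ℤ ≡ b - a
  ir-part = ℤ-Solver.solve-∀

barycentric-lattice : ∀ z i → let P = liftℤ z in
  barycentric i 𝟙 (embed z) ≡ ¼ ⊗ ⟨ + 3 * P (next i) + P (next (next (next i))) , P (next (next i)) - P (next i) ⟩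
barycentric-lattice z i = trans
  (cong₃ barycentric-form (lift-embed z (next i)) (lift-embed z (next (next i))) (lift-embed z (next (next (next i)))))
  (cong (¼ ⊗_) (lattice-form (liftℤ z (next i)) (liftℤ z (next (next i))) (liftℤ z (next (next (next i))))))

descent-bound : ∀ {p a b c} → p + a + b + c ≡ + 1 → Pos ⟨ + 3 * a + c , b - a ⟩ → a < p →
                + 2 * p ≤ a + b + + 1
descent-bound {p} {a} {b} {c} Σ≡1 pos a<p = bound (subst (λ c → Pos ⟨ + 3 * a + c , b - a ⟩) c≡ pos)
  where
  isolate : ∀ p a b c → c ≡ p + a + b + c - p - a - b
  isolate = ℤ-Solver.solve-∀

  c≡ : c ≡ + 1 - p - a - b
  c≡ = trans (isolate p a b c) (cong (λ σ → σ - p - a - b) Σ≡1)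

  A : ℤ
  A = + 3 * a + (+ 1 - p - a - b)

  slack : ∀ p a b → + 2 * (+ 3 * a + (+ 1 - p - a - b)) + + 3 * (b - a) ≡ (a + b + + 1) - + 2 * p + + 1
  slack = ℤ-Solver.solve-∀

  certificate : ∀ p a b →
    + 5 * (+ 3 * a + (+ 1 - p - a - b)) + + 7 * (b - a) + + 2 + + 2 * (a - (+ 1 + b)) + + 5 * (p - (+ 1 + a)) ≡ 0ℤ
  certificate = ℤ-Solver.solve-∀

  bound : Pos ⟨ A , b - a ⟩ → + 2 * p ≤ a + b + + 1
  bound pos with a ℤ.≤? b
  ... | yes a≤b = ℤP.0≤i-j⇒j≤i (0<x+1⇒0≤x (subst (0ℤ <_) (slack p a b)
                    (Pos⟨⟩⇒0<2a+3b {A} {b - a} pos (ℤP.i≤j⇒0≤j-i a≤b))))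
  ... | no a≰b  = contradiction (subst (0ℤ <_) (certificate p a b) positive) (ℤP.<-irrefl refl)
    where
    b<a : b < a
    b<a = ℤP.≰⇒> a≰b
    positive : 0ℤ < + 5 * A + + 7 * (b - a) + + 2 + + 2 * (a - (+ 1 + b)) + + 5 * (p - (+ 1 + a))
    positive =
      ℤP.+-mono-<-≤ (ℤP.+-mono-<-≤ (ℤP.+-mono-<-≤ (Pos⟨⟩⇒0<5a+7b {A} {b - a} pos (ℤP.i≤j⇒i-j≤0 (ℤP.<⇒≤ b<a)))
                                                 (+≤+ ℕ.z≤n))
                                  (ℤP.*-monoˡ-≤-nonNeg (+ 2) (ℤP.i≤j⇒0≤j-i (ℤP.i<j⇒suc[i]≤j b<a))))
                    (ℤP.*-monoˡ-≤-nonNeg (+ 5) (ℤP.i≤j⇒0≤j-i (ℤP.i<j⇒suc[i]≤j a<p)))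

hollow : Hollow vertex
hollow (z , l , l>0 , Σl≡1 , combl≡z) = cyclic-descent-contradiction P descent P-sum
  where
  P = liftℤ z

  P-sum : P zero + P (suc zero) + P (suc (suc zero)) + P (suc (suc (suc zero))) ≡ + 1
  P-sum = telescope (z zero) (z (suc zero)) (z (suc (suc zero)))
    where
    telescope : ∀ x y w → + 1 - x - y - w + x + y + w ≡ + 1
    telescope = ℤ-Solver.solve-∀

  positive : ∀ i → Pos ⟨ + 3 * P (next i) + P (next (next (next i))) , P (next (next i)) - P (next i) ⟩
  positive i = subst Pos (trans (cong (fromℚ (+ 4 ℚ./ 1) ⊗_) l≡) (four-quarters _))
                         (pos*Pos⇒Pos (l i) (ℚP.positive⁻¹ (+ 4 ℚ./ 1)) (subst Pos (⊖-𝟘 (l i)) (l>0 i)))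
    where
    l≡ : l i ≡ ¼ ⊗ ⟨ + 3 * P (next i) + P (next (next (next i))) , P (next (next i)) - P (next i) ⟩
    l≡ = trans (sym (barycentric-comb l i)) (trans (cong₂ (barycentric i) Σl≡1 combl≡z) (barycentric-lattice z i))
    four-quarters : ∀ x → fromℚ (+ 4 ℚ./ 1) ⊗ (¼ ⊗ x) ≡ x
    four-quarters = Solver.solve-∀ ℚ√2-ring
    ⊖-𝟘 : ∀ x → x ⊖ 𝟘 ≡ x
    ⊖-𝟘 = Solver.solve-∀ ℚ√2-ring

  descent : ∀ i → P (next i) < P i → + 2 * P i ≤ P (next i) + P (next (next i)) + + 1
  descent i = descent-bound (trans (sym (rotate-sum ℤP.+-0-commutativeMonoid P i)) P-sum) (positive i)

-- Lattice width

eval-vertex : ∀ f i → let g = 0ℤ ∷ f in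
  eval f (vertex i) ≡ t ⊗ (fromℤ (f zero) ⊕ fromℤ (f (suc zero)) ⊕ fromℤ (f (suc (suc zero))))
                      ⊕ (fromℤ (g (next i)) ⊖ φ ⊗ fromℤ (g i))
eval-vertex f zero                   = at₀ (fromℤ (f zero)) (fromℤ (f (suc zero))) (fromℤ (f (suc (suc zero))))
  where
  at₀ : ∀ u v w → u ⊗ (t ⊕ 𝟙) ⊕ v ⊗ t ⊕ w ⊗ t ≡ t ⊗ (u ⊕ v ⊕ w) ⊕ (u ⊖ φ ⊗ 𝟘)
  at₀ = Solver.solve-∀ ℚ√2-ring
eval-vertex f (suc zero)             = at₁ (fromℤ (f zero)) (fromℤ (f (suc zero))) (fromℤ (f (suc (suc zero))))
  where
  at₁ : ∀ u v w → u ⊗ (t ⊖ φ) ⊕ v ⊗ (t ⊕ 𝟙) ⊕ w ⊗ t ≡ t ⊗ (u ⊕ v ⊕ w) ⊕ (v ⊖ φ ⊗ u)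
  at₁ = Solver.solve-∀ ℚ√2-ring
eval-vertex f (suc (suc zero))       = at₂ (fromℤ (f zero)) (fromℤ (f (suc zero))) (fromℤ (f (suc (suc zero))))
  where
  at₂ : ∀ u v w → u ⊗ t ⊕ v ⊗ (t ⊖ φ) ⊕ w ⊗ (t ⊕ 𝟙) ≡ t ⊗ (u ⊕ v ⊕ w) ⊕ (w ⊖ φ ⊗ v)
  at₂ = Solver.solve-∀ ℚ√2-ring
eval-vertex f (suc (suc (suc zero))) = at₃ (fromℤ (f zero)) (fromℤ (f (suc zero))) (fromℤ (f (suc (suc zero))))
  where
  at₃ : ∀ u v w → u ⊗ t ⊕ v ⊗ t ⊕ w ⊗ (t ⊖ φ) ≡ t ⊗ (u ⊕ v ⊕ w) ⊕ (𝟘 ⊖ φ ⊗ w)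
  at₃ = Solver.solve-∀ ℚ√2-ring

y-φx≡⟨⟩ : ∀ x y → fromℤ y ⊖ φ ⊗ fromℤ x ≡ ⟨ y - x , - x ⟩
y-φx≡⟨⟩ x y = begin
  ⟨ y , 0ℤ ⟩ ⊖ ⟨ + 1 , + 1 ⟩ ⊗ ⟨ x , 0ℤ ⟩ ≡⟨ cong (⟨ y , 0ℤ ⟩ ⊖_) (⟨⟩-⊗ (+ 1) (+ 1) x 0ℤ) ⟩
  ⟨ y , 0ℤ ⟩ ⊖ ⟨ A , B ⟩                  ≡⟨ ⟨⟩-⊖ y 0ℤ A B ⟩
  ⟨ y - A , 0ℤ - B ⟩                      ≡⟨ cong₂ ⟨_,_⟩ (re-part x y) (ir-part x) ⟩
  ⟨ y - x , - x ⟩                         ∎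
  where
  open ≡-Reasoning
  A = + 1 * x + + 2 * (+ 1 * 0ℤ)
  B = + 1 * 0ℤ + + 1 * x
  re-part : ∀ x y → y - (+ 1 * x + + 2 * (+ 1 * 0ℤ)) ≡ y - x
  re-part = ℤ-Solver.solve-∀
  ir-part : ∀ x → 0ℤ - (+ 1 * 0ℤ + + 1 * x) ≡ - x
  ir-part = ℤ-Solver.solve-∀

eval-difference : ∀ f i j → let g = 0ℤ ∷ f in
  eval f (vertex j) ⊖ eval f (vertex i) ≡ ⟨ (g (next j) - g j) - (g (next i) - g i) , - g j - - g i ⟩
eval-difference f i j = begin
  eval f (vertex j) ⊖ eval f (vertex i) ≡⟨ cong₂ _⊖_ (eval-vertex f j) (eval-vertex f i) ⟩
  (T ⊕ h j) ⊖ (T ⊕ h i)                 ≡⟨ cancel T (h j) (h i) ⟩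
  h j ⊖ h i                             ≡⟨ cong₂ _⊖_ (y-φx≡⟨⟩ (g j) (g (next j))) (y-φx≡⟨⟩ (g i) (g (next i))) ⟩
  ⟨ g (next j) - g j , - g j ⟩ ⊖ ⟨ g (next i) - g i , - g i ⟩
    ≡⟨ ⟨⟩-⊖ (g (next j) - g j) (- g j) (g (next i) - g i) (- g i) ⟩
  ⟨ (g (next j) - g j) - (g (next i) - g i) , - g j - - g i ⟩ ∎
  where
  open ≡-Reasoning
  g = 0ℤ ∷ f
  T = t ⊗ (fromℤ (f zero) ⊕ fromℤ (f (suc zero)) ⊕ fromℤ (f (suc (suc zero))))
  h : Fin 4 → ℚ√2
  h k = fromℤ (g (next k)) ⊖ φ ⊗ fromℤ (g k)
  cancel : ∀ T x y → (T ⊕ x) ⊖ (T ⊕ y) ≡ x ⊖ y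
  cancel = Solver.solve-∀ ℚ√2-ring

width≥two+√2 : ∀ f → NonZeroFunctional f → WidthGE vertex f two+√2
width≥two+√2 f f≢0 = widest (descent-at-max g nonconstant) (descent-at-max (λ k → - g k) nonconstant⁻)
  where
  g : Fin 4 → ℤ
  g = 0ℤ ∷ f

  nonconstant : ¬ (∀ i j → g i ≤ g j)
  nonconstant const = f≢0 λ k → ℤP.≤-antisym (const (suc k) zero) (const zero (suc k))

  nonconstant⁻ : ¬ (∀ i j → - g i ≤ - g j)
  nonconstant⁻ const = nonconstant λ i j → ℤP.neg-cancel-≤ (const j i)

  widest : (∃ λ i → IsMax g i × g (next i) < g i) → (∃ λ j → IsMax (λ k → - g k) j × - g (next j) < - g j) →
           WidthGE vertex f two+√2
  widest (i , i-max , descent) (j , j-min , ascent) =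
    j , i , subst (two+√2 ≤ᵣ_) (sym (eval-difference f i j)) (two+√2≤⟨⟩ 2≤A 1≤B)
    where
    flip-diff : ∀ x y → y - x ≡ - (x - y)
    flip-diff = ℤ-Solver.solve-∀
    flip-neg : ∀ x y → y - x ≡ - x - - y
    flip-neg = ℤ-Solver.solve-∀
    2≤A : + 2 ≤ (g (next j) - g j) - (g (next i) - g i)
    2≤A = ℤP.+-mono-≤ (1≤y-x (ℤP.neg-cancel-< ascent)) (subst (+ 1 ≤_) (flip-diff (g (next i)) (g i)) (1≤y-x descent))
    1≤B : + 1 ≤ - g j - - g i
    1≤B = subst (+ 1 ≤_) (flip-neg (g j) (g i)) (1≤y-x (ℤP.≤-<-trans (ℤP.neg-cancel-≤ (j-min (next i))) descent))

e₃ : ℤ³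
e₃ = 0ℤ ∷ 0ℤ ∷ + 1 ∷ []

e₃≢0 : NonZeroFunctional e₃
e₃≢0 e₃≡0 with e₃≡0 (suc (suc zero))
... | ()

width-e₃<two+√2+ε : ∀ ε → 0ℚ ℚ.< ε → WidthLT vertex e₃ (two+√2 ⊕ fromℚ ε)
width-e₃<two+√2+ε ε 0<ε i j = below-two+√2+ε (D i j) 0<ε (proj₁ (bounds i j)) (proj₂ (bounds i j))
  where
  D : Fin 4 → Fin 4 → ℚ√2
  D i j = eval e₃ (vertex i) ⊖ eval e₃ (vertex j)
  bounds : ∀ i j → re (D i j) ℚ.≤ two × ir (D i j) ℚ.≤ 1ℚ
  bounds = toWitness {a? = all? λ i → all? λ j → re (D i j) ℚP.≤? two ×-dec ir (D i j) ℚP.≤? 1ℚ} _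

theorem1p1 : Σ (Fin 4 → Pt) λ v → AffinelyIndependent v × ¬ LatticePolytope v × Hollow v × LatticeWidthEq v two+√2
theorem1p1 =
  vertex , affinelyIndependent , notLattice , hollow , width≥two+√2 , λ ε 0<ε → e₃ , e₃≢0 , width-e₃<two+√2+ε ε 0<ε
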